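{- For every integer $k$ there exist a connected graph $G$ and an edge $e\in E(G)$ that is not a cut edge such that $\gamma_{\rm wcon}(G-e)-\gamma_{\rm wcon}(G)=k$.
   Context: Graphs are finite, simple, undirected. An edge $e$ is a cut edge if $G-e$ is disconnected. A set $D$ is dominating if every vertex outside $D$ has a neighbour in $D$; weakly convex if for any $a,b\in D$ some shortest $(a-b)$-path in the graph lies in $D$. $\gamma_{\rm wcon}(G)$ is the minimum size of a weakly convex dominating set of $G$. -}

module Defs where

open import Data.Nat using (ℕ; zero; suc; _≤_)
open import Data.Fin using (Fin; _≟_)
open import Data.Fin.Subset using (Subset; _∈_; ∣_∣)
open import Data.Bool using (Bool; true; false; _∧_; _∨_; not; T)
open import Data.Bool.Properties using (∧-comm; ∨-comm)
open import Data.Product using (Σ; _×_; _,_; ∃)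
open import Relation.Nullary.Decidable using (isYes)
open import Relation.Binary.PropositionalEquality using (_≡_; refl; cong; cong₂; trans)

record Graph (n : ℕ) : Set where
  field
    adj     : Fin n → Fin n → Bool
    adj-sym : ∀ x y → adj x y ≡ adj y x
    adj-irr : ∀ x → adj x x ≡ false

open Graph public

Adj : ∀ {n} → Graph n → Fin n → Fin n → Set
Adj G x y = T (adj G x y)

sameEdge : ∀ {n} → Fin n → Fin n → Fin n → Fin n → Bool
sameEdge u v x y = (isYes (x ≟ u) ∧ isYes (y ≟ v)) ∨ (isYes (x ≟ v) ∧ isYes (y ≟ u))

sameEdge-sym : ∀ {n} (u v x y : Fin n) → sameEdge u v x y ≡ sameEdge u v y x
sameEdge-sym u v x y =
  trans (cong₂ _∨_ (∧-comm (isYes (x ≟ u)) (isYes (y ≟ v)))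
                   (∧-comm (isYes (x ≟ v)) (isYes (y ≟ u))))
        (∨-comm (isYes (y ≟ v) ∧ isYes (x ≟ u)) (isYes (y ≟ u) ∧ isYes (x ≟ v)))

removeEdge : ∀ {n} → Graph n → Fin n → Fin n → Graph n
removeEdge G u v = record
  { adj     = λ x y → adj G x y ∧ not (sameEdge u v x y)
  ; adj-sym = λ x y → cong₂ _∧_ (adj-sym G x y) (cong not (sameEdge-sym u v x y))
  ; adj-irr = λ x → cong (λ b → b ∧ not (sameEdge u v x x)) (adj-irr G x)
  }

data WalkIn {n} (G : Graph n) (D : Fin n → Set) : Fin n → Fin n → ℕ → Set where
  here : ∀ {x} → D x → WalkIn G D x x 0
  step : ∀ {x y z ℓ} → D x → Adj G x y → WalkIn G D y z ℓ → WalkIn G D x z (suc ℓ)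

Everywhere : ∀ {n} → Fin n → Set
Everywhere _ = Data.Unit.⊤
  where import Data.Unit

Walk : ∀ {n} → Graph n → Fin n → Fin n → ℕ → Set
Walk G = WalkIn G Everywhere

Connected : ∀ {n} → Graph n → Set
Connected G = ∀ x y → ∃ λ ℓ → Walk G x y ℓ

-- e = uv is not a cut edge of G: G - e is connected (G is assumed connected).
NotCutEdge : ∀ {n} → Graph n → Fin n → Fin n → Set
NotCutEdge G u v = Connected (removeEdge G u v)

Dominating : ∀ {n} → Graph n → Subset n → Set
Dominating G D = ∀ x → x ∈ D Data.Sum.⊎ (∃ λ y → y ∈ D × Adj G x y)
  where import Data.Sum

-- A shortest (a-b)-path of length ℓ lying in D: a walk in D of length ℓ,
-- and every (a-b)-walk in G has length ≥ ℓ (a shortest walk is a path).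
ShortestPathIn : ∀ {n} → Graph n → Subset n → Fin n → Fin n → Set
ShortestPathIn G D a b =
  Σ ℕ λ ℓ → WalkIn G (_∈ D) a b ℓ × (∀ m → Walk G a b m → ℓ ≤ m)

WeaklyConvex : ∀ {n} → Graph n → Subset n → Set
WeaklyConvex G D = ∀ a b → a ∈ D → b ∈ D → ShortestPathIn G D a b

WCDS : ∀ {n} → Graph n → Subset n → Set
WCDS G D = Dominating G D × WeaklyConvex G D

γwcon≡ : ∀ {n} → Graph n → ℕ → Set
γwcon≡ G m = (Σ (Subset _) λ D → WCDS G D × ∣ D ∣ ≡ m)
           × (∀ D → WCDS G D → m ≤ ∣ D ∣)

-- Two facts pin down a minimum weakly convex dominating set: it contains the neighbour of
-- every leaf (once some vertex is at distance at least 2 from that leaf), and, with two of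
-- its vertices at distance 2, their common neighbour whenever it is unique.  In each graph
-- below the vertices forced in this way already form a weakly convex dominating set, so
-- γ_wcon is their number.  The graphs contain B copies of a gadget: x_i with a pendant
-- leaf, adjacent to w_i.
--   k > 0: u and v carry leaves, u is adjacent to every x_i and v to every w_i; e = uv.
--     With e the forced set is {u, v, x_i}.  Without e, w_i is the unique common neighbour
--     of x_i and v, so all B = k vertices w_i join.
--   k < 0: add a 5-cycle u z v y t with leaves at u, z, y, t; e = zv.  With e, v is the
--     unique common neighbour of z and y, which then forces every w_i as well.  Without e,
--     z and y are at distance 3 and {u, z, y, t, x_i} suffices: γ drops by B + 1.
--   k = 0: a triangle o a b with a pendant leaf at o, e = ab; {o} is minimum in both graphs.
module Submission where

open import Defs
open import Data.Bool using (Bool; true; false; _∧_; _∨_; T)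
open import Data.Bool.Properties using (T-∧; T-∨; T-≡; ∧-identityʳ; ∨-identityʳ; ∨-comm)
open import Data.Empty using (⊥; ⊥-elim)
open import Data.Fin using (Fin; zero; suc; _≟_; _↑ˡ_; _↑ʳ_; combine; remQuot)
open import Data.Fin.Patterns using (0F; 1F; 2F; 3F; 4F; 5F; 6F; 7F; 8F)
open import Data.Fin.Properties using (+↔⊎; remQuot-combine; combine-remQuot)
open import Data.Fin.Subset using (Subset; _∈_; ∣_∣; _⊆_)
open import Data.Fin.Subset.Properties using (p⊆q⇒∣p∣≤∣q∣)
open import Data.Integer using (ℤ; +_; -[1+_]; _-_; _⊖_)
open import Data.Integer.Properties using ([+m]-[+n]≡m⊖n; +-cancelˡ-⊖)
open import Data.Nat using (ℕ; zero; suc; _+_; _*_; _≤_; z≤n; s≤s)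
open import Data.Nat.Properties using (+-identityʳ)
open import Data.Nat.Tactic.RingSolver using (solve-∀)
open import Data.Product using (Σ; ∃; _×_; _,_; proj₁; proj₂; uncurry)
import Data.Product as Product
open import Data.Sum using (_⊎_; inj₁; inj₂)
import Data.Sum as Sum
open import Data.Sum.Function.Propositional using (_⊎-↔_)
open import Data.Unit using (tt)
open import Data.Vec using (tabulate)
open import Data.Vec.Properties using (lookup∘tabulate; lookup⇒[]=; []=⇒lookup; tabulate-cong)
open import Function using (_∘_; Equivalence)
open import Function.Bundles using (_↔_; Inverse; mk↔ₛ′)
open import Function.Properties.Inverse using (↔-refl; ↔-sym; ↔-trans)
open import Relation.Binary.PropositionalEquality
open import Relation.Nullary using (¬_; yes; no)
open import Relation.Nullary.Decidable using (isYes; toWitness; fromWitness)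

open Equivalence using (to; from)

-- Walks and weakly convex dominating sets

module _ {n} (G : Graph n) where

  Adj-sym : ∀ {a b} → Adj G a b → Adj G b a
  Adj-sym {a} {b} = subst T (adj-sym G a b)

  Adj⇒≢ : ∀ {a b} → Adj G a b → a ≢ b
  Adj⇒≢ {a} ab refl = subst T (adj-irr G a) ab

  module _ {D : Fin n → Set} where

    WalkIn-start : ∀ {a b ℓ} → WalkIn G D a b ℓ → D a
    WalkIn-start (here d)     = d
    WalkIn-start (step d _ _) = d

    snoc : ∀ {a b c ℓ} → WalkIn G D a b ℓ → Adj G b c → D c → WalkIn G D a c (suc ℓ)
    snoc (here d)      bc dc = step d bc (here dc)
    snoc (step d ab w) bc dc = step d ab (snoc w bc dc)

    reverse : ∀ {a b ℓ} → WalkIn G D a b ℓ → WalkIn G D b a ℓ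
    reverse (here d)      = here d
    reverse (step d ab w) = snoc (reverse w) (Adj-sym ab) d

    _++_ : ∀ {a b c ℓ k} → WalkIn G D a b ℓ → WalkIn G D b c k → WalkIn G D a c (ℓ + k)
    here _      ++ w′ = w′
    step d ab w ++ w′ = step d ab (w ++ w′)

  ShortestPathIn-sym : ∀ {D a b} → ShortestPathIn G D a b → ShortestPathIn G D b a
  ShortestPathIn-sym (ℓ , w , shortest) = ℓ , reverse w , λ m w′ → shortest m (reverse w′)

  dist≥1 : ∀ {a b} → a ≢ b → ∀ m → Walk G a b m → 1 ≤ m
  dist≥1 a≢b zero    (here _) = ⊥-elim (a≢b refl)
  dist≥1 a≢b (suc m) _        = s≤s z≤n

  dist≥2 : ∀ {a b} → a ≢ b → ¬ Adj G a b → ∀ m → Walk G a b m → 2 ≤ m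
  dist≥2 a≢b ¬ab zero          (here _)             = ⊥-elim (a≢b refl)
  dist≥2 a≢b ¬ab (suc zero)    (step _ ab (here _)) = ⊥-elim (¬ab ab)
  dist≥2 a≢b ¬ab (suc (suc m)) _                    = s≤s (s≤s z≤n)

  dist≥3 : ∀ {a b} → a ≢ b → ¬ Adj G a b → (∀ c → Adj G a c → Adj G c b → ⊥) →
           ∀ m → Walk G a b m → 3 ≤ m
  dist≥3 a≢b ¬ab ¬acb zero                (here _)                         = ⊥-elim (a≢b refl)
  dist≥3 a≢b ¬ab ¬acb (suc zero)          (step _ ab (here _))             = ⊥-elim (¬ab ab)
  dist≥3 a≢b ¬ab ¬acb (suc (suc zero))    (step _ ac (step _ cb (here _))) = ⊥-elim (¬acb _ ac cb)
  dist≥3 a≢b ¬ab ¬acb (suc (suc (suc m))) _                                = s≤s (s≤s (s≤s z≤n))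

  leaf-walk-support∈ : ∀ {D : Subset n} {l s b ℓ} → (∀ a → Adj G l a → a ≡ s) → l ≢ b →
                       WalkIn G (_∈ D) l b ℓ → s ∈ D
  leaf-walk-support∈     onlyNeighbour l≢b (here _)      = ⊥-elim (l≢b refl)
  leaf-walk-support∈ {D} onlyNeighbour l≢b (step _ la w) =
    subst (_∈ D) (onlyNeighbour _ la) (WalkIn-start w)

  leaf-support∈ : ∀ {D l s t} → WCDS G D → (∀ a → Adj G l a → a ≡ s) → l ≢ t → ¬ Adj G t l →
                  s ∈ D
  leaf-support∈ {D} {l} {s} {t} (dominating , convex) onlyNeighbour l≢t ¬tl
    with dominating l | dominating t
  ... | inj₂ (a , a∈D , la) | _                   = subst (_∈ D) (onlyNeighbour a la) a∈D
  ... | inj₁ l∈D            | inj₁ t∈D            =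
    leaf-walk-support∈ onlyNeighbour l≢t (proj₁ (proj₂ (convex l t l∈D t∈D)))
  ... | inj₁ l∈D            | inj₂ (a , a∈D , ta) =
    leaf-walk-support∈ onlyNeighbour (λ { refl → ¬tl ta }) (proj₁ (proj₂ (convex l a l∈D a∈D)))

  commonNeighbour∈ : ∀ {D a b s} → WCDS G D → a ∈ D → b ∈ D → a ≢ b → ¬ Adj G a b →
                     Adj G a s → Adj G s b → (∀ c → Adj G a c → Adj G c b → c ≡ s) → s ∈ D
  commonNeighbour∈ {D} {a} {b} {s} (_ , convex) a∈D b∈D a≢b ¬ab as sb onlyCommon
    with convex a b a∈D b∈D
  ... | _ , w , shortest = middle w (shortest 2 (step tt as (step tt sb (here tt))))
    where
    middle : ∀ {ℓ} → WalkIn G (_∈ D) a b ℓ → ℓ ≤ 2 → s ∈ D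
    middle (here _)                           _ = ⊥-elim (a≢b refl)
    middle (step _ ab (here _))               _ = ⊥-elim (¬ab ab)
    middle (step _ ac (step c∈D cb (here _))) _ = subst (_∈ D) (onlyCommon _ ac cb) c∈D
    middle (step _ _ (step _ _ (step _ _ _))) (s≤s (s≤s ()))

  hub⇒Connected : (h : Fin n) → (∀ a → ∃ λ ℓ → Walk G a h ℓ) → Connected G
  hub⇒Connected h toHub a b =
    proj₁ (toHub a) + proj₁ (toHub b) , proj₂ (toHub a) ++ reverse (proj₂ (toHub b))

  least⇒γwcon≡ : ∀ {D} → WCDS G D → (∀ D′ → WCDS G D′ → D ⊆ D′) → γwcon≡ G ∣ D ∣
  least⇒γwcon≡ {D} wcds least =
    (D , wcds , refl) , λ D′ wcds′ → p⊆q⇒∣p∣≤∣q∣ (least D′ wcds′)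

module _ {n} {u v : Fin n} where

  sameEdge⇒≡ : ∀ {a b} → T (sameEdge u v a b) → (a ≡ u × b ≡ v) ⊎ (a ≡ v × b ≡ u)
  sameEdge⇒≡ {a} {b} =
    Sum.map witnesses witnesses ∘
      T-∨ {isYes (a ≟ u) ∧ isYes (b ≟ v)} {isYes (a ≟ v) ∧ isYes (b ≟ u)} .to
    where
    witnesses : ∀ {a b c d : Fin n} → T (isYes (a ≟ b) ∧ isYes (c ≟ d)) → a ≡ b × c ≡ d
    witnesses {a} {b} {c} {d} =
      Product.map toWitness toWitness ∘ T-∧ {isYes (a ≟ b)} {isYes (c ≟ d)} .to

  sameEdge-irrefl : u ≢ v → ∀ a → sameEdge u v a a ≡ false
  sameEdge-irrefl u≢v a with sameEdge u v a a in eq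
  ... | false = refl
  ... | true with sameEdge⇒≡ {a} {a} (T-≡ .from eq)
  ...   | inj₁ (refl , refl) = ⊥-elim (u≢v refl)
  ...   | inj₂ (refl , refl) = ⊥-elim (u≢v refl)

-- sameEdge comes first so that adjacency at a vertex off the edge reduces to that of H.
addEdge : ∀ {n} (H : Graph n) (u v : Fin n) → u ≢ v → Graph n
addEdge H u v u≢v = record
  { adj     = λ a b → sameEdge u v a b ∨ adj H a b
  ; adj-sym = λ a b → cong₂ _∨_ (sameEdge-sym u v a b) (adj-sym H a b)
  ; adj-irr = λ a → cong₂ _∨_ (sameEdge-irrefl u≢v a) (adj-irr H a)
  }

addEdge-Adj : ∀ {n} (H : Graph n) {u v} (u≢v : u ≢ v) → Adj (addEdge H u v u≢v) u v
addEdge-Adj H {u} {v} u≢v with u ≟ u | v ≟ v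
... | yes _  | yes _  = tt
... | no u≢u | _      = ⊥-elim (u≢u refl)
... | yes _  | no v≢v = ⊥-elim (v≢v refl)

removeEdge-addEdge : ∀ {n} (H : Graph n) {u v} (u≢v : u ≢ v) → ¬ Adj H u v →
                     ∀ a b → adj (removeEdge (addEdge H u v u≢v) u v) a b ≡ adj H a b
removeEdge-addEdge H {u} {v} u≢v ¬uv a b with sameEdge u v a b in eq
... | false = ∧-identityʳ (adj H a b)
... | true with adj H a b in ab
...   | false = refl
...   | true with sameEdge⇒≡ {u = u} {v} {a} {b} (T-≡ .from eq)
...     | inj₁ (refl , refl) = ⊥-elim (¬uv (T-≡ .from ab))
...     | inj₂ (refl , refl) = ⊥-elim (¬uv (Adj-sym H (T-≡ .from ab)))

removeEdge-Connected⇒Connected : ∀ {n} (G : Graph n) u v → Connected (removeEdge G u v) → Connected G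
removeEdge-Connected⇒Connected G u v connected a b = proj₁ (connected a b) , keep (proj₂ (connected a b))
  where
  keep : ∀ {a b ℓ} → Walk (removeEdge G u v) a b ℓ → Walk G a b ℓ
  keep (here d)      = here d
  keep (step d ab w) = step d (proj₁ (T-∧ .to ab)) (keep w)

∣tabulate-+∣ : ∀ m {n} (g : Fin (m + n) → Bool) →
               ∣ tabulate g ∣ ≡ ∣ tabulate (g ∘ (_↑ˡ n)) ∣ + ∣ tabulate (g ∘ (m ↑ʳ_)) ∣
∣tabulate-+∣ zero    g = refl
∣tabulate-+∣ (suc m) g with g zero
... | true  = cong suc (∣tabulate-+∣ m (g ∘ suc))
... | false = ∣tabulate-+∣ m (g ∘ suc)

∣tabulate-*∣ : ∀ B {k} (g : Fin (B * k) → Bool) (h : Fin k → Bool) →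
               (∀ i r → g (combine {B} i r) ≡ h r) → ∣ tabulate g ∣ ≡ B * ∣ tabulate h ∣
∣tabulate-*∣ zero        g h g≗h = refl
∣tabulate-*∣ (suc B) {k} g h g≗h = trans (∣tabulate-+∣ k g) (cong₂ _+_
  (cong ∣_∣ (tabulate-cong (g≗h zero)))
  (∣tabulate-*∣ B (g ∘ (k ↑ʳ_)) h (λ i → g≗h (suc i))))

-- c named vertices and B copies of a gadget with k vertices.
Vertex : ℕ → ℕ → ℕ → Set
Vertex c B k = Fin c ⊎ (Fin B × Fin k)

Fin*↔× : ∀ {B k} → Fin (B * k) ↔ (Fin B × Fin k)
Fin*↔× {B} {k} = mk↔ₛ′ (remQuot k) (uncurry combine) (uncurry remQuot-combine) (combine-remQuot {B} k)

Vertex↔Fin : ∀ {c B k} → Vertex c B k ↔ Fin (c + B * k)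
Vertex↔Fin = ↔-trans (↔-refl ⊎-↔ ↔-sym Fin*↔×) (↔-sym +↔⊎)

∣tabulate-Vertex∣ : ∀ {c B k} (f : Vertex c B k → Bool) (h : Fin k → Bool) →
                    (∀ i r → f (inj₂ (i , r)) ≡ h r) →
                    ∣ tabulate (f ∘ Inverse.from Vertex↔Fin) ∣ ≡ ∣ tabulate (f ∘ inj₁) ∣ + B * ∣ tabulate h ∣
∣tabulate-Vertex∣ {c} {B} f h f≗h = trans (∣tabulate-+∣ c _) (cong₂ _+_
  (cong ∣_∣ (tabulate-cong (cong f ∘ from∘to ∘ inj₁)))
  (∣tabulate-*∣ B _ h λ i r → trans (cong f (from∘to (inj₂ (i , r)))) (f≗h i r)))
  where from∘to = Inverse.strictlyInverseʳ (Vertex↔Fin {c} {B})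

+[m+n]-+m≡+n : ∀ m n → + (m + n) - + m ≡ + n
+[m+n]-+m≡+n m n = begin
  + (m + n) - + m    ≡⟨ [+m]-[+n]≡m⊖n (m + n) m ⟩
  (m + n) ⊖ m        ≡⟨ cong ((m + n) ⊖_) (+-identityʳ m) ⟨
  (m + n) ⊖ (m + 0)  ≡⟨ +-cancelˡ-⊖ m n 0 ⟩
  + n                ∎
  where open ≡-Reasoning

+m-+[m+1+n]≡-[1+n] : ∀ m n → + m - + (m + suc n) ≡ -[1+ n ]
+m-+[m+1+n]≡-[1+n] m n = begin
  + m - + (m + suc n)    ≡⟨ [+m]-[+n]≡m⊖n m (m + suc n) ⟩
  m ⊖ (m + suc n)        ≡⟨ cong (_⊖ (m + suc n)) (+-identityʳ m) ⟨
  (m + 0) ⊖ (m + suc n)  ≡⟨ +-cancelˡ-⊖ m 0 (suc n) ⟩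
  -[1+ n ]               ∎
  where open ≡-Reasoning

-- Graphs on an enumerated vertex type

module Enumerated {V : Set} {n} (V↔Fin : V ↔ Fin n) where
  open Inverse V↔Fin public using ()
    renaming (to to enc; from to dec; strictlyInverseˡ to enc∘dec; strictlyInverseʳ to dec∘enc)

  enc-injective : ∀ {p q} → enc p ≡ enc q → p ≡ q
  enc-injective {p} {q} e = trans (sym (dec∘enc p)) (trans (cong dec e) (dec∘enc q))

  enc-≢ : ∀ {p q} → p ≢ q → enc p ≢ enc q
  enc-≢ p≢q = p≢q ∘ enc-injective

  graph : (A : V → V → Bool) → (∀ p q → A p q ≡ A q p) → (∀ p → A p p ≡ false) → Graph n
  graph A A-sym A-irr = record
    { adj     = λ a b → A (dec a) (dec b)
    ; adj-sym = λ a b → A-sym (dec a) (dec b)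
    ; adj-irr = λ a → A-irr (dec a)
    }

  module View (G : Graph n) (A : V → V → Bool) (enc-adj : ∀ p q → adj G (enc p) (enc q) ≡ A p q) where

    Adjᵛ : V → V → Set
    Adjᵛ p q = T (A p q)

    enc-Adj : ∀ {p q} → Adjᵛ p q → Adj G (enc p) (enc q)
    enc-Adj {p} {q} = subst T (sym (enc-adj p q))

    Adj-dec : ∀ {a b} → Adj G a b → Adjᵛ (dec a) (dec b)
    Adj-dec {a} {b} ab =
      subst T (enc-adj (dec a) (dec b)) (subst₂ (Adj G) (sym (enc∘dec a)) (sym (enc∘dec b)) ab)

    Adj-decˡ : ∀ {p b} → Adj G (enc p) b → Adjᵛ p (dec b)
    Adj-decˡ {p} {b} = subst (λ r → Adjᵛ r (dec b)) (dec∘enc p) ∘ Adj-dec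

    Adj-decʳ : ∀ {a q} → Adj G a (enc q) → Adjᵛ (dec a) q
    Adj-decʳ {a} {q} = subst (Adjᵛ (dec a)) (dec∘enc q) ∘ Adj-dec

    enc-¬Adj : ∀ {p q} → ¬ Adjᵛ p q → ¬ Adj G (enc p) (enc q)
    enc-¬Adj {p} {q} ¬pq = ¬pq ∘ subst₂ Adjᵛ (dec∘enc p) (dec∘enc q) ∘ Adj-dec

    enc-unique : ∀ {s} {P : V → Set} → (∀ q → P q → q ≡ s) → ∀ a → P (dec a) → a ≡ enc s
    enc-unique unique a Pa = trans (sym (enc∘dec a)) (cong enc (unique (dec a) Pa))

    leaf-support∈ᵛ : ∀ {D} → WCDS G D → ∀ l s t → (∀ q → Adjᵛ l q → q ≡ s) → l ≢ t →
                     ¬ Adjᵛ t l → enc s ∈ D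
    leaf-support∈ᵛ wcds l s t onlyNeighbour l≢t ¬tl =
      leaf-support∈ G wcds (λ a → enc-unique onlyNeighbour a ∘ Adj-decˡ) (enc-≢ l≢t) (enc-¬Adj ¬tl)

    commonNeighbour∈ᵛ : ∀ {D} → WCDS G D → ∀ a b s → enc a ∈ D → enc b ∈ D → a ≢ b →
                        ¬ Adjᵛ a b → Adjᵛ a s → Adjᵛ s b → (∀ c → Adjᵛ a c → Adjᵛ c b → c ≡ s) →
                        enc s ∈ D
    commonNeighbour∈ᵛ wcds a b s a∈D b∈D a≢b ¬ab as sb onlyCommon =
      commonNeighbour∈ G wcds a∈D b∈D (enc-≢ a≢b) (enc-¬Adj ¬ab) (enc-Adj as) (enc-Adj sb)
        λ c ac cb → enc-unique (λ c → uncurry (onlyCommon c)) c (Adj-decˡ ac , Adj-decʳ cb)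

    -- Here and in path₀ … path₃ below, adjacency and membership proofs are implicit: between
    -- concrete vertices they reduce to ⊤ and are filled in by eta.
    data Walkᵛ : V → V → ℕ → Set where
      stop : ∀ {p} → Walkᵛ p p 0
      hop  : ∀ {p} q {r ℓ} {pq : Adjᵛ p q} → Walkᵛ q r ℓ → Walkᵛ p r (suc ℓ)

    enc-Walk : ∀ {p q ℓ} → Walkᵛ p q ℓ → Walk G (enc p) (enc q) ℓ
    enc-Walk stop                = here tt
    enc-Walk (hop _ {pq = pq} w) = step tt (enc-Adj pq) (enc-Walk w)

    hubᵛ⇒Connected : (h : V) → (∀ p → ∃ λ ℓ → Walkᵛ p h ℓ) → Connected G
    hubᵛ⇒Connected h toHub = hub⇒Connected G (enc h) λ a →
      proj₁ (toHub (dec a)) ,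
      subst (λ b → Walk G b (enc h) _) (enc∘dec a) (enc-Walk (proj₂ (toHub (dec a))))

    module Candidate (member : V → Bool) where

      D : Subset n
      D = tabulate (member ∘ dec)

      In : V → Set
      In p = T (member p)

      ∈D⇒In : ∀ {a} → a ∈ D → In (dec a)
      ∈D⇒In {a} a∈D = T-≡ .from (trans (sym (lookup∘tabulate (member ∘ dec) a)) ([]=⇒lookup a∈D))

      In⇒enc∈D : ∀ {p} → In p → enc p ∈ D
      In⇒enc∈D {p} p∈ = lookup⇒[]= (enc p) D
        (trans (lookup∘tabulate (member ∘ dec) (enc p)) (trans (cong member (dec∘enc p)) (T-≡ .to p∈)))

      SP : V → V → Set
      SP p q = ShortestPathIn G D (enc p) (enc q)

      path₀ : ∀ p {p∈ : In p} → SP p p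
      path₀ p {p∈} = 0 , here (In⇒enc∈D p∈) , λ _ _ → z≤n

      path₁ : ∀ p q {p∈ : In p} {q∈ : In q} {pq : Adjᵛ p q} → SP p q
      path₁ p q {p∈} {q∈} {pq} =
        1 , step (In⇒enc∈D p∈) (enc-Adj pq) (here (In⇒enc∈D q∈)) ,
        dist≥1 G (Adj⇒≢ G (enc-Adj pq))

      path₂ : ∀ p c q {p∈ : In p} {c∈ : In c} {q∈ : In q} {pc : Adjᵛ p c} {cq : Adjᵛ c q} →
              p ≢ q → ¬ Adjᵛ p q → SP p q
      path₂ p c q {p∈} {c∈} {q∈} {pc} {cq} p≢q ¬pq =
        2 , step (In⇒enc∈D p∈) (enc-Adj pc) (step (In⇒enc∈D c∈) (enc-Adj cq) (here (In⇒enc∈D q∈))) ,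
        dist≥2 G (enc-≢ p≢q) (enc-¬Adj ¬pq)

      path₃ : ∀ p c d q {p∈ : In p} {c∈ : In c} {d∈ : In d} {q∈ : In q}
              {pc : Adjᵛ p c} {cd : Adjᵛ c d} {dq : Adjᵛ d q} →
              p ≢ q → ¬ Adjᵛ p q → (∀ r → Adjᵛ p r → Adjᵛ r q → ⊥) → SP p q
      path₃ p c d q {p∈} {c∈} {d∈} {q∈} {pc} {cd} {dq} p≢q ¬pq noCommon =
        3 , step (In⇒enc∈D p∈) (enc-Adj pc) (step (In⇒enc∈D c∈) (enc-Adj cd)
              (step (In⇒enc∈D d∈) (enc-Adj dq) (here (In⇒enc∈D q∈)))) ,
        dist≥3 G (enc-≢ p≢q) (enc-¬Adj ¬pq) λ r pr rq → noCommon (dec r) (Adj-decˡ pr) (Adj-decʳ rq)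

      Dominatingᵛ : Set
      Dominatingᵛ = ∀ p → In p ⊎ ∃ λ q → In q × Adjᵛ p q

      WeaklyConvexᵛ : Set
      WeaklyConvexᵛ = ∀ p q → In p → In q → SP p q

      Forced : Set
      Forced = ∀ {D′} → WCDS G D′ → ∀ p → In p → enc p ∈ D′

      Dominatingᵛ⇒Dominating : Dominatingᵛ → Dominating G D
      Dominatingᵛ⇒Dominating dominated a with dominated (dec a)
      ... | inj₁ a∈            = inj₁ (subst (_∈ D) (enc∘dec a) (In⇒enc∈D a∈))
      ... | inj₂ (q , q∈ , aq) =
        inj₂ (enc q , In⇒enc∈D q∈ , subst (λ b → Adj G b (enc q)) (enc∘dec a) (enc-Adj aq))

      WeaklyConvexᵛ⇒WeaklyConvex : WeaklyConvexᵛ → WeaklyConvex G D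
      WeaklyConvexᵛ⇒WeaklyConvex convex a b a∈D b∈D =
        subst₂ (ShortestPathIn G D) (enc∘dec a) (enc∘dec b)
          (convex (dec a) (dec b) (∈D⇒In a∈D) (∈D⇒In b∈D))

      γwcon≡∣D∣ : Forced → Dominatingᵛ → WeaklyConvexᵛ → γwcon≡ G ∣ D ∣
      γwcon≡∣D∣ forced dominated convex =
        least⇒γwcon≡ G (Dominatingᵛ⇒Dominating dominated , WeaklyConvexᵛ⇒WeaklyConvex convex)
          λ D′ wcds′ {a} a∈D → subst (_∈ D′) (enc∘dec a) (forced wcds′ (dec a) (∈D⇒In a∈D))

Realisable : ℤ → Set
Realisable k =
  Σ ℕ λ n → Σ (Graph n) λ G → Σ (Fin n) λ u → Σ (Fin n) λ v →
    Connected G × Adj G u v × NotCutEdge G u v ×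
    Σ ℕ λ m₁ → Σ ℕ λ m₂ →
      γwcon≡ G m₁ × γwcon≡ (removeEdge G u v) m₂ × (+ m₂ - + m₁ ≡ k)

module EdgeRemoval {V : Set} {n} (V↔Fin : V ↔ Fin n)
  (E : V → V → Bool) (E-irr : ∀ p → E p p ≡ false)
  (e₁ e₂ : V) (e₁≢e₂ : e₁ ≢ e₂) (¬e₁e₂ : ¬ T (E e₁ e₂ ∨ E e₂ e₁)) where

  open Enumerated V↔Fin public

  A : V → V → Bool
  A p q = E p q ∨ E q p

  A+e : V → V → Bool
  A+e p q = sameEdge (enc e₁) (enc e₂) (enc p) (enc q) ∨ A p q

  H : Graph n
  H = graph A (λ p q → ∨-comm (E p q) (E q p)) (λ p → cong₂ _∨_ (E-irr p) (E-irr p))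

  G : Graph n
  G = addEdge H (enc e₁) (enc e₂) (enc-≢ e₁≢e₂)

  G-e : Graph n
  G-e = removeEdge G (enc e₁) (enc e₂)

  enc-adj-H : ∀ p q → adj H (enc p) (enc q) ≡ A p q
  enc-adj-H p q = cong₂ A (dec∘enc p) (dec∘enc q)

  enc-adj-G : ∀ p q → adj G (enc p) (enc q) ≡ A+e p q
  enc-adj-G p q = cong (sameEdge (enc e₁) (enc e₂) (enc p) (enc q) ∨_) (enc-adj-H p q)

  enc-adj-G-e : ∀ p q → adj G-e (enc p) (enc q) ≡ A p q
  enc-adj-G-e p q = trans
    (removeEdge-addEdge H (enc-≢ e₁≢e₂) (¬e₁e₂ ∘ subst T (enc-adj-H e₁ e₂)) (enc p) (enc q))
    (enc-adj-H p q)

  module ViewG = View G A+e enc-adj-G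
  module ViewG-e = View G-e A enc-adj-G-e

  witness : ∀ {m₁ m₂ k} → Connected G-e → γwcon≡ G m₁ → γwcon≡ G-e m₂ → + m₂ - + m₁ ≡ k →
            Realisable k
  witness connected γG γG-e difference =
    n , G , enc e₁ , enc e₂ , removeEdge-Connected⇒Connected G _ _ connected ,
    addEdge-Adj H (enc-≢ e₁≢e₂) , connected , _ , _ , γG , γG-e , difference

-- The constructions

module Zero where
  pattern o = 0F
  pattern l = 1F
  pattern a = 2F
  pattern b = 3F

  E : Fin 4 → Fin 4 → Bool
  E o l = true
  E o a = true
  E o b = true
  E _ _ = false

  E-irrefl : ∀ p → E p p ≡ false
  E-irrefl = λ { o → refl ; l → refl ; a → refl ; b → refl }

  open EdgeRemoval ↔-refl E E-irrefl a b (λ ()) (λ ())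

  l-leaf : ∀ q → T (A l q) → q ≡ o
  l-leaf = λ { o _ → refl ; l () ; a () ; b () }

  centre : Fin 4 → Bool
  centre o = true
  centre _ = false

  module InG where
    open ViewG
    open Candidate centre

    γ : γwcon≡ G 1
    γ = γwcon≡∣D∣ (λ { wcds o _ → leaf-support∈ᵛ wcds l o a l-leaf (λ ()) (λ ()) })
      (λ { o → inj₁ tt ; l → inj₂ (o , tt , tt) ; a → inj₂ (o , tt , tt) ; b → inj₂ (o , tt , tt) })
      (λ { o o _ _ → path₀ o })

  module InG-e where
    open ViewG-e
    open Candidate centre

    γ : γwcon≡ G-e 1
    γ = γwcon≡∣D∣ (λ { wcds o _ → leaf-support∈ᵛ wcds l o a l-leaf (λ ()) (λ ()) })
      (λ { o → inj₁ tt ; l → inj₂ (o , tt , tt) ; a → inj₂ (o , tt , tt) ; b → inj₂ (o , tt , tt) })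
      (λ { o o _ _ → path₀ o })

    connected : Connected G-e
    connected = hubᵛ⇒Connected o λ
      { o → _ , stop ; l → _ , hop o stop ; a → _ , hop o stop ; b → _ , hop o stop }

  realisable : Realisable (+ 0)
  realisable = witness InG-e.connected InG.γ InG-e.γ refl

pattern x i  = inj₂ (i , 0F)
pattern lx i = inj₂ (i , 1F)
pattern w i  = inj₂ (i , 2F)

module Positive (m : ℕ) where
  B : ℕ
  B = suc m

  pattern u  = inj₁ 0F
  pattern lu = inj₁ 1F
  pattern v  = inj₁ 2F
  pattern lv = inj₁ 3F

  E : Vertex 4 B 3 → Vertex 4 B 3 → Bool
  E u     lu     = true
  E v     lv     = true
  E u     (x _)  = true
  E (x i) (lx j) = isYes (i ≟ j)
  E (x i) (w j)  = isYes (i ≟ j)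
  E (w _) v      = true
  E _     _      = false

  E-irrefl : ∀ p → E p p ≡ false
  E-irrefl = λ { u → refl ; lu → refl ; v → refl ; lv → refl
               ; (x _) → refl ; (lx _) → refl ; (w _) → refl }

  open EdgeRemoval Vertex↔Fin E E-irrefl u v (λ ()) (λ ())

  x—w : ∀ i → T (A (x i) (w i))
  x—w i = subst T (sym (∨-identityʳ _)) (fromWitness refl)

  x—w⇒≡ : ∀ {i j} → T (A (x i) (w j)) → i ≡ j
  x—w⇒≡ = toWitness ∘ subst T (∨-identityʳ _)

  lu-leaf : ∀ q → T (A lu q) → q ≡ u
  lu-leaf = λ { u _ → refl ; lu () ; v () ; lv () ; (x _) () ; (lx _) () ; (w _) () }

  lv-leaf : ∀ q → T (A lv q) → q ≡ v
  lv-leaf = λ { v _ → refl ; u () ; lu () ; lv () ; (x _) () ; (lx _) () ; (w _) () }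

  lx-leaf : ∀ i q → T (A (lx i) q) → q ≡ x i
  lx-leaf i = λ { (x j) j≡i → cong x (toWitness j≡i) ; u () ; lu () ; v () ; lv () ; (lx _) () ; (w _) () }

  module InG where
    open ViewG
    member : Vertex 4 B 3 → Bool
    member u     = true
    member v     = true
    member (x _) = true
    member _     = false

    open Candidate member

    forced : Forced
    forced wcds u     _ = leaf-support∈ᵛ wcds lu u v lu-leaf (λ ()) (λ ())
    forced wcds v     _ = leaf-support∈ᵛ wcds lv v u lv-leaf (λ ()) (λ ())
    forced wcds (x i) _ = leaf-support∈ᵛ wcds (lx i) (x i) u (lx-leaf i) (λ ()) (λ ())

    dominated : Dominatingᵛ
    dominated u      = inj₁ tt
    dominated lu     = inj₂ (u , tt , tt)
    dominated v      = inj₁ tt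
    dominated lv     = inj₂ (v , tt , tt)
    dominated (x _)  = inj₁ tt
    dominated (lx i) = inj₂ (x i , tt , fromWitness refl)
    dominated (w _)  = inj₂ (v , tt , tt)

    from-u : ∀ q → In q → SP u q
    from-u u     _ = path₀ u
    from-u v     _ = path₁ u v
    from-u (x i) _ = path₁ u (x i)

    from-v : ∀ q → In q → SP v q
    from-v u     _ = ShortestPathIn-sym G (from-u v _)
    from-v v     _ = path₀ v
    from-v (x i) _ = path₂ v u (x i) (λ ()) (λ ())

    from-x : ∀ i q → In q → SP (x i) q
    from-x i u     _ = ShortestPathIn-sym G (from-u (x i) _)
    from-x i v     _ = ShortestPathIn-sym G (from-v (x i) _)
    from-x i (x j) _ with i ≟ j
    ... | yes refl = path₀ (x i)
    ... | no i≢j   = path₂ (x i) u (x j) (λ { refl → i≢j refl }) (λ ())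

    convex : WeaklyConvexᵛ
    convex u     q _ = from-u q
    convex v     q _ = from-v q
    convex (x i) q _ = from-x i q

    ∣D∣≡ : ∣ D ∣ ≡ 2 + B * 1
    ∣D∣≡ = ∣tabulate-Vertex∣ member (λ { 0F → true ; _ → false })
      λ { _ 0F → refl ; _ 1F → refl ; _ 2F → refl }

    γ : γwcon≡ G (2 + B * 1)
    γ = subst (γwcon≡ G) ∣D∣≡ (γwcon≡∣D∣ forced dominated convex)

  module InG-e where
    open ViewG-e
    member : Vertex 4 B 3 → Bool
    member u     = true
    member v     = true
    member (x _) = true
    member (w _) = true
    member _     = false

    open Candidate member

    u-v-noCommon : ∀ r → Adjᵛ u r → Adjᵛ r v → ⊥
    u-v-noCommon = λ { u () ; lu _ () ; v () ; lv () ; (x _) _ () ; (lx _) () ; (w _) () }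

    x-w-noCommon : ∀ i j → ∀ r → Adjᵛ (x i) r → Adjᵛ r (w j) → ⊥
    x-w-noCommon i j = λ { u _ () ; lu () ; v () ; lv () ; (x _) () ; (lx _) _ () ; (w _) _ () }

    x-v-onlyCommon : ∀ i c → Adjᵛ (x i) c → Adjᵛ c v → c ≡ w i
    x-v-onlyCommon i = λ
      { (w j) xw _ → cong w (sym (x—w⇒≡ xw)) ; u _ () ; lu () ; v () ; lv () ; (x _) () ; (lx _) _ () }

    forced : Forced
    forced wcds u     _ = leaf-support∈ᵛ wcds lu u v lu-leaf (λ ()) (λ ())
    forced wcds v     _ = leaf-support∈ᵛ wcds lv v u lv-leaf (λ ()) (λ ())
    forced wcds (x i) _ = leaf-support∈ᵛ wcds (lx i) (x i) u (lx-leaf i) (λ ()) (λ ())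
    forced wcds (w i) _ = commonNeighbour∈ᵛ wcds (x i) v (w i) (forced wcds (x i) _) (forced wcds v _)
      (λ ()) (λ ()) (x—w i) _ (x-v-onlyCommon i)

    dominated : Dominatingᵛ
    dominated u      = inj₁ tt
    dominated lu     = inj₂ (u , tt , tt)
    dominated v      = inj₁ tt
    dominated lv     = inj₂ (v , tt , tt)
    dominated (x _)  = inj₁ tt
    dominated (lx i) = inj₂ (x i , tt , fromWitness refl)
    dominated (w _)  = inj₁ tt

    from-u : ∀ q → In q → SP u q
    from-u u     _ = path₀ u
    from-u v     _ = path₃ u (x 0F) (w 0F) v (λ ()) (λ ()) u-v-noCommon
    from-u (x i) _ = path₁ u (x i)
    from-u (w i) _ = path₂ u (x i) (w i) {cq = x—w i} (λ ()) (λ ())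

    from-v : ∀ q → In q → SP v q
    from-v u     _ = ShortestPathIn-sym G-e (from-u v _)
    from-v v     _ = path₀ v
    from-v (x i) _ = path₂ v (w i) (x i) {cq = fromWitness refl} (λ ()) (λ ())
    from-v (w i) _ = path₁ v (w i)

    from-x : ∀ i q → In q → SP (x i) q
    from-x i u     _ = ShortestPathIn-sym G-e (from-u (x i) _)
    from-x i v     _ = ShortestPathIn-sym G-e (from-v (x i) _)
    from-x i (x j) _ with i ≟ j
    ... | yes refl = path₀ (x i)
    ... | no i≢j   = path₂ (x i) u (x j) (λ { refl → i≢j refl }) (λ ())
    from-x i (w j) _ with i ≟ j
    ... | yes refl = path₁ (x i) (w i) {pq = x—w i}
    ... | no i≢j   = path₃ (x i) u (x j) (w j) {dq = x—w j} (λ ()) (i≢j ∘ x—w⇒≡) (x-w-noCommon i j)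

    from-w : ∀ i q → In q → SP (w i) q
    from-w i u     _ = ShortestPathIn-sym G-e (from-u (w i) _)
    from-w i v     _ = ShortestPathIn-sym G-e (from-v (w i) _)
    from-w i (x j) _ = ShortestPathIn-sym G-e (from-x j (w i) _)
    from-w i (w j) _ with i ≟ j
    ... | yes refl = path₀ (w i)
    ... | no i≢j   = path₂ (w i) v (w j) (λ { refl → i≢j refl }) (λ ())

    convex : WeaklyConvexᵛ
    convex u     q _ = from-u q
    convex v     q _ = from-v q
    convex (x i) q _ = from-x i q
    convex (w i) q _ = from-w i q

    ∣D∣≡ : ∣ D ∣ ≡ 2 + B * 2
    ∣D∣≡ = ∣tabulate-Vertex∣ member (λ { 1F → false ; _ → true })
      λ { _ 0F → refl ; _ 1F → refl ; _ 2F → refl }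

    γ : γwcon≡ G-e (2 + B * 2)
    γ = subst (γwcon≡ G-e) ∣D∣≡ (γwcon≡∣D∣ forced dominated convex)

    connected : Connected G-e
    connected = hubᵛ⇒Connected v λ
      { v      → _ , stop
      ; lv     → _ , hop v stop
      ; (w _)  → _ , hop v stop
      ; (x i)  → _ , hop (w i) {pq = x—w i} (hop v stop)
      ; (lx i) → _ , hop (x i) {pq = fromWitness refl} (hop (w i) {pq = x—w i} (hop v stop))
      ; u      → _ , hop (x 0F) (hop (w 0F) (hop v stop))
      ; lu     → _ , hop u (hop (x 0F) (hop (w 0F) (hop v stop)))
      }

  realisable : Realisable (+ B)
  realisable = witness InG-e.connected InG.γ InG-e.γ (begin
    + (2 + B * 2) - + (2 + B * 1)        ≡⟨ cong (λ k → + k - + (2 + B * 1)) (arithmetic B) ⟩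
    + ((2 + B * 1) + B) - + (2 + B * 1)  ≡⟨ +[m+n]-+m≡+n (2 + B * 1) B ⟩
    + B                                  ∎)
    where
    open ≡-Reasoning
    arithmetic : ∀ b → 2 + b * 2 ≡ (2 + b * 1) + b
    arithmetic = solve-∀

module Negative (m : ℕ) where
  pattern u  = inj₁ 0F
  pattern lu = inj₁ 1F
  pattern z  = inj₁ 2F
  pattern lz = inj₁ 3F
  pattern y  = inj₁ 4F
  pattern ly = inj₁ 5F
  pattern v  = inj₁ 6F
  pattern t  = inj₁ 7F
  pattern lt = inj₁ 8F

  E : Vertex 9 m 3 → Vertex 9 m 3 → Bool
  E u     lu     = true
  E z     lz     = true
  E y     ly     = true
  E t     lt     = true
  E u     z      = true
  E y     v      = true
  E y     t      = true
  E t     u      = true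
  E u     (x _)  = true
  E (x i) (lx j) = isYes (i ≟ j)
  E (x i) (w j)  = isYes (i ≟ j)
  E (w _) v      = true
  E _     _      = false

  E-irrefl : ∀ p → E p p ≡ false
  E-irrefl = λ { u → refl ; lu → refl ; z → refl ; lz → refl ; y → refl ; ly → refl ; v → refl
               ; t → refl ; lt → refl ; (x _) → refl ; (lx _) → refl ; (w _) → refl }

  open EdgeRemoval Vertex↔Fin E E-irrefl z v (λ ()) (λ ())

  x—w : ∀ i → T (A (x i) (w i))
  x—w i = subst T (sym (∨-identityʳ _)) (fromWitness refl)

  x—w⇒≡ : ∀ {i j} → T (A (x i) (w j)) → i ≡ j
  x—w⇒≡ = toWitness ∘ subst T (∨-identityʳ _)

  lu-leaf : ∀ q → T (A lu q) → q ≡ u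
  lu-leaf = λ { u _ → refl ; lu () ; z () ; lz () ; y () ; ly () ; v () ; t () ; lt ()
              ; (x _) () ; (lx _) () ; (w _) () }

  lz-leaf : ∀ q → T (A lz q) → q ≡ z
  lz-leaf = λ { z _ → refl ; u () ; lu () ; lz () ; y () ; ly () ; v () ; t () ; lt ()
              ; (x _) () ; (lx _) () ; (w _) () }

  ly-leaf : ∀ q → T (A ly q) → q ≡ y
  ly-leaf = λ { y _ → refl ; u () ; lu () ; z () ; lz () ; ly () ; v () ; t () ; lt ()
              ; (x _) () ; (lx _) () ; (w _) () }

  lt-leaf : ∀ q → T (A lt q) → q ≡ t
  lt-leaf = λ { t _ → refl ; u () ; lu () ; z () ; lz () ; y () ; ly () ; v () ; lt ()
              ; (x _) () ; (lx _) () ; (w _) () }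

  lx-leaf : ∀ i q → T (A (lx i) q) → q ≡ x i
  lx-leaf i = λ { (x j) j≡i → cong x (toWitness j≡i) ; u () ; lu () ; z () ; lz () ; y () ; ly () ; v () ; t ()
                ; lt () ; (lx _) () ; (w _) () }

  module InG where
    open ViewG
    member : Vertex 9 m 3 → Bool
    member u     = true
    member z     = true
    member y     = true
    member v     = true
    member t     = true
    member (x _) = true
    member (w _) = true
    member _     = false

    open Candidate member

    y-x-noCommon : ∀ i r → Adjᵛ y r → Adjᵛ r (x i) → ⊥
    y-x-noCommon i = λ { u () ; lu () ; z () ; lz () ; y () ; ly _ () ; v _ () ; t _ () ; lt ()
                       ; (x _) () ; (lx _) () ; (w _) () }

    t-w-noCommon : ∀ i r → Adjᵛ t r → Adjᵛ r (w i) → ⊥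
    t-w-noCommon i = λ { u _ () ; lu () ; z () ; lz () ; y _ () ; ly () ; v () ; t () ; lt _ ()
                       ; (x _) () ; (lx _) () ; (w _) () }

    x-w-noCommon : ∀ i j r → Adjᵛ (x i) r → Adjᵛ r (w j) → ⊥
    x-w-noCommon i j = λ { u _ () ; lu () ; z () ; lz () ; y () ; ly () ; v () ; t () ; lt ()
                         ; (x _) () ; (lx _) _ () ; (w _) _ () }

    z-y-onlyCommon : ∀ c → Adjᵛ z c → Adjᵛ c y → c ≡ v
    z-y-onlyCommon = λ { v _ _ → refl ; u _ () ; lu () ; z () ; lz _ () ; y () ; ly () ; t () ; lt ()
                       ; (x _) () ; (lx _) () ; (w _) () }

    x-v-onlyCommon : ∀ i c → Adjᵛ (x i) c → Adjᵛ c v → c ≡ w i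
    x-v-onlyCommon i = λ { (w j) xw _ → cong w (sym (x—w⇒≡ xw)) ; u _ () ; lu () ; z () ; lz () ; y () ; ly ()
                         ; v () ; t () ; lt () ; (x _) () ; (lx _) _ () }

    v∈ : ∀ {D′} → WCDS G D′ → enc v ∈ D′
    forced : Forced
    forced wcds u     _ = leaf-support∈ᵛ wcds lu u v lu-leaf (λ ()) (λ ())
    forced wcds z     _ = leaf-support∈ᵛ wcds lz z v lz-leaf (λ ()) (λ ())
    forced wcds y     _ = leaf-support∈ᵛ wcds ly y u ly-leaf (λ ()) (λ ())
    forced wcds t     _ = leaf-support∈ᵛ wcds lt t v lt-leaf (λ ()) (λ ())
    forced wcds (x i) _ = leaf-support∈ᵛ wcds (lx i) (x i) v (lx-leaf i) (λ ()) (λ ())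
    forced wcds v     _ = v∈ wcds
    forced wcds (w i) _ = commonNeighbour∈ᵛ wcds (x i) v (w i) (forced wcds (x i) _) (v∈ wcds)
      (λ ()) (λ ()) (x—w i) _ (x-v-onlyCommon i)
    v∈ wcds = commonNeighbour∈ᵛ wcds z y v (forced wcds z _) (forced wcds y _)
      (λ ()) (λ ()) _ _ z-y-onlyCommon

    dominated : Dominatingᵛ
    dominated u      = inj₁ tt
    dominated lu     = inj₂ (u , tt , tt)
    dominated z      = inj₁ tt
    dominated lz     = inj₂ (z , tt , tt)
    dominated y      = inj₁ tt
    dominated ly     = inj₂ (y , tt , tt)
    dominated v      = inj₁ tt
    dominated t      = inj₁ tt
    dominated lt     = inj₂ (t , tt , tt)
    dominated (x _)  = inj₁ tt
    dominated (lx i) = inj₂ (x i , tt , fromWitness refl)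
    dominated (w _)  = inj₁ tt

    from-u : ∀ q → In q → SP u q
    from-u u     _ = path₀ u
    from-u z     _ = path₁ u z
    from-u y     _ = path₂ u t y (λ ()) (λ ())
    from-u v     _ = path₂ u z v (λ ()) (λ ())
    from-u t     _ = path₁ u t
    from-u (x i) _ = path₁ u (x i)
    from-u (w i) _ = path₂ u (x i) (w i) {cq = x—w i} (λ ()) (λ ())

    from-z : ∀ q → In q → SP z q
    from-z u     _ = ShortestPathIn-sym G (from-u z _)
    from-z z     _ = path₀ z
    from-z y     _ = path₂ z v y (λ ()) (λ ())
    from-z v     _ = path₁ z v
    from-z t     _ = path₂ z u t (λ ()) (λ ())
    from-z (x i) _ = path₂ z u (x i) (λ ()) (λ ())
    from-z (w i) _ = path₂ z v (w i) (λ ()) (λ ())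

    from-y : ∀ q → In q → SP y q
    from-y u     _ = ShortestPathIn-sym G (from-u y _)
    from-y z     _ = ShortestPathIn-sym G (from-z y _)
    from-y y     _ = path₀ y
    from-y v     _ = path₁ y v
    from-y t     _ = path₁ y t
    from-y (x i) _ = path₃ y t u (x i) (λ ()) (λ ()) (y-x-noCommon i)
    from-y (w i) _ = path₂ y v (w i) (λ ()) (λ ())

    from-v : ∀ q → In q → SP v q
    from-v u     _ = ShortestPathIn-sym G (from-u v _)
    from-v z     _ = ShortestPathIn-sym G (from-z v _)
    from-v y     _ = ShortestPathIn-sym G (from-y v _)
    from-v v     _ = path₀ v
    from-v t     _ = path₂ v y t (λ ()) (λ ())
    from-v (x i) _ = path₂ v (w i) (x i) {cq = fromWitness refl} (λ ()) (λ ())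
    from-v (w i) _ = path₁ v (w i)

    from-t : ∀ q → In q → SP t q
    from-t u     _ = ShortestPathIn-sym G (from-u t _)
    from-t z     _ = ShortestPathIn-sym G (from-z t _)
    from-t y     _ = ShortestPathIn-sym G (from-y t _)
    from-t v     _ = ShortestPathIn-sym G (from-v t _)
    from-t t     _ = path₀ t
    from-t (x i) _ = path₂ t u (x i) (λ ()) (λ ())
    from-t (w i) _ = path₃ t u (x i) (w i) {dq = x—w i} (λ ()) (λ ()) (t-w-noCommon i)

    from-x : ∀ i q → In q → SP (x i) q
    from-x i u     _ = ShortestPathIn-sym G (from-u (x i) _)
    from-x i z     _ = ShortestPathIn-sym G (from-z (x i) _)
    from-x i y     _ = ShortestPathIn-sym G (from-y (x i) _)
    from-x i v     _ = ShortestPathIn-sym G (from-v (x i) _)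
    from-x i t     _ = ShortestPathIn-sym G (from-t (x i) _)
    from-x i (x j) _ with i ≟ j
    ... | yes refl = path₀ (x i)
    ... | no i≢j   = path₂ (x i) u (x j) (λ { refl → i≢j refl }) (λ ())
    from-x i (w j) _ with i ≟ j
    ... | yes refl = path₁ (x i) (w i) {pq = x—w i}
    ... | no i≢j   = path₃ (x i) u (x j) (w j) {dq = x—w j} (λ ()) (i≢j ∘ x—w⇒≡) (x-w-noCommon i j)

    from-w : ∀ i q → In q → SP (w i) q
    from-w i u     _ = ShortestPathIn-sym G (from-u (w i) _)
    from-w i z     _ = ShortestPathIn-sym G (from-z (w i) _)
    from-w i y     _ = ShortestPathIn-sym G (from-y (w i) _)
    from-w i v     _ = ShortestPathIn-sym G (from-v (w i) _)
    from-w i t     _ = ShortestPathIn-sym G (from-t (w i) _)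
    from-w i (x j) _ = ShortestPathIn-sym G (from-x j (w i) _)
    from-w i (w j) _ with i ≟ j
    ... | yes refl = path₀ (w i)
    ... | no i≢j   = path₂ (w i) v (w j) (λ { refl → i≢j refl }) (λ ())

    convex : WeaklyConvexᵛ
    convex u     q _ = from-u q
    convex z     q _ = from-z q
    convex y     q _ = from-y q
    convex v     q _ = from-v q
    convex t     q _ = from-t q
    convex (x i) q _ = from-x i q
    convex (w i) q _ = from-w i q

    ∣D∣≡ : ∣ D ∣ ≡ 5 + m * 2
    ∣D∣≡ = ∣tabulate-Vertex∣ member (λ { 1F → false ; _ → true })
      λ { _ 0F → refl ; _ 1F → refl ; _ 2F → refl }

    γ : γwcon≡ G (5 + m * 2)
    γ = subst (γwcon≡ G) ∣D∣≡ (γwcon≡∣D∣ forced dominated convex)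

  module InG-e where
    open ViewG-e
    member : Vertex 9 m 3 → Bool
    member u     = true
    member z     = true
    member y     = true
    member t     = true
    member (x _) = true
    member _     = false

    open Candidate member

    z-y-noCommon : ∀ r → Adjᵛ z r → Adjᵛ r y → ⊥
    z-y-noCommon = λ { u _ () ; lu () ; z () ; lz _ () ; y () ; ly () ; v () ; t () ; lt ()
                     ; (x _) () ; (lx _) () ; (w _) () }

    y-x-noCommon : ∀ i r → Adjᵛ y r → Adjᵛ r (x i) → ⊥
    y-x-noCommon i = λ { u () ; lu () ; z () ; lz () ; y () ; ly _ () ; v _ () ; t _ () ; lt ()
                       ; (x _) () ; (lx _) () ; (w _) () }

    forced : Forced
    forced wcds u     _ = leaf-support∈ᵛ wcds lu u v lu-leaf (λ ()) (λ ())
    forced wcds z     _ = leaf-support∈ᵛ wcds lz z v lz-leaf (λ ()) (λ ())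
    forced wcds y     _ = leaf-support∈ᵛ wcds ly y u ly-leaf (λ ()) (λ ())
    forced wcds t     _ = leaf-support∈ᵛ wcds lt t v lt-leaf (λ ()) (λ ())
    forced wcds (x i) _ = leaf-support∈ᵛ wcds (lx i) (x i) v (lx-leaf i) (λ ()) (λ ())

    dominated : Dominatingᵛ
    dominated u      = inj₁ tt
    dominated lu     = inj₂ (u , tt , tt)
    dominated z      = inj₁ tt
    dominated lz     = inj₂ (z , tt , tt)
    dominated y      = inj₁ tt
    dominated ly     = inj₂ (y , tt , tt)
    dominated v      = inj₂ (y , tt , tt)
    dominated t      = inj₁ tt
    dominated lt     = inj₂ (t , tt , tt)
    dominated (x _)  = inj₁ tt
    dominated (lx i) = inj₂ (x i , tt , fromWitness refl)
    dominated (w i)  = inj₂ (x i , tt , fromWitness refl)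

    from-u : ∀ q → In q → SP u q
    from-u u     _ = path₀ u
    from-u z     _ = path₁ u z
    from-u y     _ = path₂ u t y (λ ()) (λ ())
    from-u t     _ = path₁ u t
    from-u (x i) _ = path₁ u (x i)

    from-z : ∀ q → In q → SP z q
    from-z u     _ = ShortestPathIn-sym G-e (from-u z _)
    from-z z     _ = path₀ z
    from-z y     _ = path₃ z u t y (λ ()) (λ ()) z-y-noCommon
    from-z t     _ = path₂ z u t (λ ()) (λ ())
    from-z (x i) _ = path₂ z u (x i) (λ ()) (λ ())

    from-y : ∀ q → In q → SP y q
    from-y u     _ = ShortestPathIn-sym G-e (from-u y _)
    from-y z     _ = ShortestPathIn-sym G-e (from-z y _)
    from-y y     _ = path₀ y
    from-y t     _ = path₁ y t
    from-y (x i) _ = path₃ y t u (x i) (λ ()) (λ ()) (y-x-noCommon i)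

    from-t : ∀ q → In q → SP t q
    from-t u     _ = ShortestPathIn-sym G-e (from-u t _)
    from-t z     _ = ShortestPathIn-sym G-e (from-z t _)
    from-t y     _ = ShortestPathIn-sym G-e (from-y t _)
    from-t t     _ = path₀ t
    from-t (x i) _ = path₂ t u (x i) (λ ()) (λ ())

    from-x : ∀ i q → In q → SP (x i) q
    from-x i u     _ = ShortestPathIn-sym G-e (from-u (x i) _)
    from-x i z     _ = ShortestPathIn-sym G-e (from-z (x i) _)
    from-x i y     _ = ShortestPathIn-sym G-e (from-y (x i) _)
    from-x i t     _ = ShortestPathIn-sym G-e (from-t (x i) _)
    from-x i (x j) _ with i ≟ j
    ... | yes refl = path₀ (x i)
    ... | no i≢j   = path₂ (x i) u (x j) (λ { refl → i≢j refl }) (λ ())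

    convex : WeaklyConvexᵛ
    convex u     q _ = from-u q
    convex z     q _ = from-z q
    convex y     q _ = from-y q
    convex t     q _ = from-t q
    convex (x i) q _ = from-x i q

    ∣D∣≡ : ∣ D ∣ ≡ 4 + m * 1
    ∣D∣≡ = ∣tabulate-Vertex∣ member (λ { 0F → true ; _ → false })
      λ { _ 0F → refl ; _ 1F → refl ; _ 2F → refl }

    γ : γwcon≡ G-e (4 + m * 1)
    γ = subst (γwcon≡ G-e) ∣D∣≡ (γwcon≡∣D∣ forced dominated convex)

    connected : Connected G-e
    connected = hubᵛ⇒Connected u λ
      { u      → _ , stop
      ; lu     → _ , hop u stop
      ; z      → _ , hop u stop
      ; lz     → _ , hop z (hop u stop)
      ; t      → _ , hop u stop
      ; lt     → _ , hop t (hop u stop)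
      ; y      → _ , hop t (hop u stop)
      ; ly     → _ , hop y (hop t (hop u stop))
      ; v      → _ , hop y (hop t (hop u stop))
      ; (x _)  → _ , hop u stop
      ; (lx i) → _ , hop (x i) {pq = fromWitness refl} (hop u stop)
      ; (w i)  → _ , hop (x i) {pq = fromWitness refl} (hop u stop)
      }

  realisable : Realisable -[1+ m ]
  realisable = witness InG-e.connected InG.γ InG-e.γ (begin
    + (4 + m * 1) - + (5 + m * 2)            ≡⟨ cong (λ k → + (4 + m * 1) - + k) (arithmetic m) ⟩
    + (4 + m * 1) - + ((4 + m * 1) + suc m)  ≡⟨ +m-+[m+1+n]≡-[1+n] (4 + m * 1) m ⟩
    -[1+ m ]                                 ∎)
    where
    open ≡-Reasoning
    arithmetic : ∀ b → 5 + b * 2 ≡ (4 + b * 1) + suc b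
    arithmetic = solve-∀

theorem4p1 : (k : ℤ) →
    Σ ℕ λ n → Σ (Graph n) λ G → Σ (Fin n) λ u → Σ (Fin n) λ v →
    Connected G × Adj G u v × NotCutEdge G u v ×
    Σ ℕ λ m₁ → Σ ℕ λ m₂ →
    γwcon≡ G m₁ × γwcon≡ (removeEdge G u v) m₂ × (+ m₂ - + m₁ ≡ k)
theorem4p1 (+ zero)  = Zero.realisable
theorem4p1 (+ suc m) = Positive.realisable m
theorem4p1 -[1+ m ]  = Negative.realisable m
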